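{- Let $n,t$ be integers with $2\le t\le n/2$, let $0\le c\le 1/32$, and let \[S=\{tk^2+4\ell : k,\ell\in\mathbb{Z},\ 1\le k\le \sqrt{(n-t+1)/t},\ 0\le \ell\le ct\}\cup\{t-4\ell:\ \ell\in\mathbb{Z},\ 0\le \ell\le ct\}.\] For $i\in S$ let $\pi_S(i)=\prod_{i'\in S,\ i'\ne i}|i-i'|$, and let $i^*\in S$ be a minimizer of $\pi_S$ over $S$ satisfying $(1-4c)t\le i^*\le (1+4c)t$. Let $T=S\cup\{i^*-1,i^*+1\}$ and, for a sign bit $s\in\{0,1\}$, define the real polynomial \[P(x)=(-1)^s\frac{\pi_S(i^*)}{n!}\prod_{j\in\{0,1,\dots,n\}\setminus T}(x-j).\] Then: (i) if $r=tk^2+4\ell$ with integers $k\ge 2$ and $0\le \ell\le ct$, then $\binom{n}{r}|P(r)|\le \dfrac{1}{t^2(k^2-2)^2}$; (ii) if $v=i^*+4\ell$ for a nonzero integer $\ell$ with $0\le v\le n$, then $\binom{n}{v}|P(v)|\le \dfrac{1}{16\ell^2-1}$.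
   Formalization: The parameter c, with $0\le c\le 1/32$, is taken to be rational. -}

module Defs where

open import Data.Bool.Base using (Bool; true; false; _∧_; _∨_; not; if_then_else_)
open import Data.Nat.Base using (ℕ; zero; suc; _+_; _*_; _∸_; _≤ᵇ_; _≡ᵇ_; ∣_-_∣; _!)
open import Data.Nat.Properties using (_!≢0)
open import Data.Integer.Base using (ℤ; +_)
open import Data.List.Base using (List; map; filterᵇ; upTo; foldr)
open import Data.Bool.ListAction using (any)
open import Data.Nat.ListAction using (product)
open import Data.Rational.Base using (ℚ; _/_; 1ℚ; 0ℚ; -_) renaming (_*_ to _*ℚ_; _-_ to _-ℚ_)
open import Data.Rational.Properties using (_≤?_)
open import Relation.Nullary.Decidable using (⌊_⌋)

ℕ→ℚ : ℕ → ℚ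
ℕ→ℚ n = + n / 1

-- reciprocal of a natural number, 1/d as a rational (only used with d > 0;
-- the value at 0 is an irrelevant convention)
recipℕ : ℕ → ℚ
recipℕ zero    = 0ℚ
recipℕ (suc d) = + 1 / suc d

prodℚ : List ℚ → ℚ
prodℚ = foldr _*ℚ_ 1ℚ

le-ct : ℚ → ℕ → ℕ → Bool
le-ct c t ℓ = ⌊ ℕ→ℚ ℓ ≤? (c *ℚ ℕ→ℚ t) ⌋

-- For natural k ≥ 1, k ≤ √((n-t+1)/t) ⟺ t·k² ≤ n - t + 1 (t > 0, n ≥ 2t).
-- Such k satisfy k ≤ n, and ℓ ≤ ct ≤ t/32 gives ℓ ≤ t, so the searches
-- below over k ∈ [0,n], ℓ ∈ [0,t] are exhaustive (under the hypotheses c ≤ 1/32).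
-- "i = t - 4ℓ" is written i + 4ℓ = t.
inS : ℕ → ℕ → ℚ → ℕ → Bool
inS n t c i =
  any (λ k → any (λ ℓ → (1 ≤ᵇ k) ∧ (t * k * k ≤ᵇ (n ∸ t) + 1) ∧ le-ct c t ℓ
                          ∧ (i ≡ᵇ t * k * k + 4 * ℓ))
                 (upTo (suc t)))
      (upTo (suc n))
  ∨ any (λ ℓ → le-ct c t ℓ ∧ (i + 4 * ℓ ≡ᵇ t)) (upTo (suc t))

-- S as an explicit duplicate-free list: every element is ≤ (n - t + 1) + 4t,
-- so filtering [0, n + 4t + 2) is exhaustive.
Slist : ℕ → ℕ → ℚ → List ℕ
Slist n t c = filterᵇ (inS n t c) (upTo (n + 4 * t + 2))

piS : ℕ → ℕ → ℚ → ℕ → ℕ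
piS n t c i = product (map (λ i' → ∣ i - i' ∣) (filterᵇ (λ i' → not (i' ≡ᵇ i)) (Slist n t c)))

inT : ℕ → ℕ → ℚ → ℕ → ℕ → Bool
inT n t c istar j = inS n t c j ∨ (j + 1 ≡ᵇ istar) ∨ (j ≡ᵇ istar + 1)

-- (-1)^s for s ∈ {0,1} encoded as Bool (false = 0, true = 1)
signℚ : Bool → ℚ
signℚ false = 1ℚ
signℚ true  = - 1ℚ

P : ℕ → ℕ → ℚ → ℕ → Bool → ℚ → ℚ
P n t c istar s x =
  signℚ s *ℚ ((+ piS n t c istar) / (n !)) {{n !≢0}}
    *ℚ prodℚ (map (λ j → x -ℚ ℕ→ℚ j) (filterᵇ (λ j → not (inT n t c istar j)) (upTo (suc n))))

-- For x ∈ S with x ≤ n, the factors |x − j| (j ≤ n, j ≠ x) of x! (n − x)! split into those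
-- with j ∉ T, whose product is |P(x)| up to the constant π_S(i*)/n!, those with j ∈ S ∖ {x},
-- whose product is π_S(x), and the two with j = i* ± 1. The latter lie outside S, since the
-- elements of S below 4t are all ≡ t (mod 4) and i* ≤ (1+4c)t < 2t. Hence
-- C(n,x) |P(x)| = π_S(i*) / (π_S(x) |x − i* + 1| |x − i* − 1|) ≤ 1 / (|x − i* + 1| |x − i* − 1|)
-- by minimality of π_S(i*). For other x the left side is 0: P vanishes on [0,n] ∖ T, and
-- C(n,x) = 0 beyond n. Parts (i) and (ii) follow by bounding the two distances below by
-- t(k² − 2), resp. computing them as 4|ℓ| ± 1.
module Submission where

open import Defs
open import Data.Bool.Base using (Bool; true)
open import Data.Nat.Base using (ℕ; _+_; _*_; _∸_; _≤_)
open import Data.Nat.Combinatorics using (_C_)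
open import Data.Integer.Base using (ℤ; +_; ∣_∣) renaming (_+_ to _+ℤ_; _*_ to _*ℤ_)
open import Data.Rational.Base using (ℚ; _/_; 0ℚ; 1ℚ) renaming (_≤_ to _≤ℚ_; _+_ to _+ℚ_; _-_ to _-ℚ_; _*_ to _*ℚ_; ∣_∣ to ∣_∣ℚ)
open import Data.Product using (_×_)
open import Relation.Binary.PropositionalEquality using (_≡_; _≢_)

open import Data.Bool.Base using (false; T; not; _∧_; _∨_; if_then_else_)
open import Data.Bool.Properties using (T-≡; T-∧; T-∨)
open import Data.Empty using (⊥; ⊥-elim)
import Data.Integer.Base as ℤ
open import Data.Integer.Base using (-[1+_])
import Data.Integer.Properties as ℤ
open import Data.List.Base using (List; []; _∷_; map; filterᵇ; upTo; applyUpTo)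
open import Data.Bool.ListAction using (any)
open import Data.List.Relation.Unary.Any using (satisfied)
open import Data.List.Relation.Unary.Any.Properties using (any⁻)
open import Data.Nat.Base hiding (_/_)
open import Data.Nat.Combinatorics using (nCk≡n!/k![n-k]!; k>n⇒nCk≡0; k![n∸k]!∣n!)
open import Data.Nat.DivMod using (_%_; [m+n]%n≡m%n; [m+kn]%n≡m%n; m/n*n≡m)
open import Data.Nat.ListAction using (product)
open import Data.Nat.Properties
open import Algebra.Properties.CommutativeSemigroup *-commutativeSemigroup using (interchange)
open import Data.Nat.Tactic.RingSolver using (solve-∀)
open import Data.Integer.Tactic.RingSolver using () renaming (solve-∀ to solve-∀ℤ)
open import Data.Product using (_,_)
import Data.Rational.Base as ℚ
open import Data.Rational.Base using (toℚᵘ)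
import Data.Rational.Properties as ℚP
open import Data.Rational.Properties using (toℚᵘ-fromℚᵘ; toℚᵘ-injective; toℚᵘ-mono-≤; toℚᵘ-cancel-≤; toℚᵘ-homo-*; toℚᵘ-homo-+; toℚᵘ-homo‿-; toℚᵘ-homo-∣-∣)
open import Data.Rational.Unnormalised.Base using (mkℚᵘ; *≤*; *≡*)
import Data.Rational.Unnormalised.Base as ℚᵘ
import Data.Rational.Unnormalised.Properties as ℚᵘ
open import Data.Sum using (inj₁; inj₂)
open import Function.Base using (_∘_; id)
open import Function.Bundles using (Equivalence)
open Equivalence using (to; from)
open import Relation.Binary.PropositionalEquality using (refl; sym; trans; cong; cong₂; subst; subst₂; module ≡-Reasoning)
open import Relation.Nullary.Decidable using (Dec; toWitness; yes; no; T?)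

-- Products over initial segments of ℕ

∏< : ℕ → (ℕ → ℕ) → ℕ
∏< zero    g = 1
∏< (suc N) g = g 0 * ∏< N (g ∘ suc)

product-applyUpTo : ∀ N (f g : ℕ → ℕ) → product (map g (applyUpTo f N)) ≡ ∏< N (g ∘ f)
product-applyUpTo zero    f g = refl
product-applyUpTo (suc N) f g = cong (g (f 0) *_) (product-applyUpTo N (f ∘ suc) g)

product-upTo : ∀ N g → product (map g (upTo N)) ≡ ∏< N g
product-upTo N = product-applyUpTo N id

product-filterᵇ : ∀ {A : Set} (p : A → Bool) (f : A → ℕ) xs →
                  product (map f (filterᵇ p xs)) ≡ product (map (λ j → if p j then f j else 1) xs)
product-filterᵇ p f []       = refl
product-filterᵇ p f (x ∷ xs) with p x
... | true  = cong (f x *_) (product-filterᵇ p f xs)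
... | false = trans (product-filterᵇ p f xs) (sym (+-identityʳ _))

∏<-cong : ∀ N (g h : ℕ → ℕ) → (∀ j → g j ≡ h j) → ∏< N g ≡ ∏< N h
∏<-cong zero    g h g≗h = refl
∏<-cong (suc N) g h g≗h = cong₂ _*_ (g≗h 0) (∏<-cong N (g ∘ suc) (h ∘ suc) (g≗h ∘ suc))

∏<-ones : ∀ N {g} → (∀ j → g j ≡ 1) → ∏< N g ≡ 1
∏<-ones zero    g≗1 = refl
∏<-ones (suc N) g≗1 = cong₂ _*_ (g≗1 0) (∏<-ones N (g≗1 ∘ suc))

∏<-distrib-* : ∀ N g h → ∏< N (λ j → g j * h j) ≡ ∏< N g * ∏< N h
∏<-distrib-* zero    g h = refl
∏<-distrib-* (suc N) g h =
  trans (cong (g 0 * h 0 *_) (∏<-distrib-* N (g ∘ suc) (h ∘ suc))) (interchange (g 0) (h 0) _ _)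

∏<-distrib-*⁴ : ∀ N e f g h →
                ∏< N (λ j → e j * (f j * (g j * h j))) ≡ ∏< N e * (∏< N f * (∏< N g * ∏< N h))
∏<-distrib-*⁴ N e f g h =
  trans (∏<-distrib-* N e (λ j → f j * (g j * h j)))
        (cong (∏< N e *_) (trans (∏<-distrib-* N f (λ j → g j * h j)) (cong (∏< N f *_) (∏<-distrib-* N g h))))

∏<-+ : ∀ a b g → ∏< (a + b) g ≡ ∏< a g * ∏< b (λ j → g (a + j))
∏<-+ zero    b g = sym (+-identityʳ _)
∏<-+ (suc a) b g = trans (cong (g 0 *_) (∏<-+ a b (g ∘ suc))) (sym (*-assoc (g 0) _ _))

∏<-zero : ∀ N g a → a < N → g a ≡ 0 → ∏< N g ≡ 0
∏<-zero (suc N) g zero    _         ga≡0 = cong (_* ∏< N (g ∘ suc)) ga≡0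
∏<-zero (suc N) g (suc a) (s≤s a<N) ga≡0 =
  trans (cong (g 0 *_) (∏<-zero N (g ∘ suc) a a<N ga≡0)) (*-zeroʳ (g 0))

¬T⇒T-not : ∀ {b} → (T b → ⊥) → T (not b)
¬T⇒T-not {true}  ¬b = ¬b _
¬T⇒T-not {false} _  = _

if-T : ∀ {A : Set} {b} {x y : A} → T b → (if b then x else y) ≡ x
if-T {b = true} _ = refl

if-¬T : ∀ {A : Set} {b} {x y : A} → (T b → ⊥) → (if b then x else y) ≡ y
if-¬T {b = true}  ¬b = ⊥-elim (¬b _)
if-¬T {b = false} _  = refl

∏<-select : ∀ N (p : ℕ → Bool) (g : ℕ → ℕ) a → a < N → T (p a) → (∀ j → T (p j) → j ≡ a) →
            ∏< N (λ j → if p j then g j else 1) ≡ g a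
∏<-select (suc N) p g zero _ pa unique =
  trans (cong₂ _*_ (if-T pa) (∏<-ones N (λ j → if-¬T (λ pj → 1+n≢0 (unique (suc j) pj)))))
        (*-identityʳ (g 0))
∏<-select (suc N) p g (suc a) (s≤s a<N) pa unique =
  trans (cong₂ _*_ (if-¬T (λ p0 → 0≢1+n (unique 0 p0)))
                   (∏<-select N (p ∘ suc) (g ∘ suc) a a<N pa (λ j pj → suc-injective (unique (suc j) pj))))
        (*-identityˡ (g (suc a)))

∏<-snoc : ∀ N g → ∏< (suc N) g ≡ ∏< N g * g N
∏<-snoc zero    g = trans (*-identityʳ (g 0)) (sym (*-identityˡ (g 0)))
∏<-snoc (suc N) g = trans (cong (g 0 *_) (∏<-snoc N (g ∘ suc))) (sym (*-assoc (g 0) _ _))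

∏<-suc≡! : ∀ N → ∏< N suc ≡ N !
∏<-suc≡! zero    = refl
∏<-suc≡! (suc N) = begin
  ∏< (suc N) suc    ≡⟨ ∏<-snoc N suc ⟩
  ∏< N suc * suc N  ≡⟨ cong (_* suc N) (∏<-suc≡! N) ⟩
  N ! * suc N       ≡⟨ *-comm (N !) (suc N) ⟩
  suc N !           ∎
  where open ≡-Reasoning

∏<-∣x-j∣≡x!*[n∸x]! : ∀ x n → x ≤ n → ∏< (suc n) (λ j → if j ≡ᵇ x then 1 else ∣ x - j ∣) ≡ x ! * (n ∸ x) !
∏<-∣x-j∣≡x!*[n∸x]! zero    n       _         = cong (1 *_) (∏<-suc≡! n)
∏<-∣x-j∣≡x!*[n∸x]! (suc x) (suc n) (s≤s x≤n) =
  trans (cong (suc x *_) (∏<-∣x-j∣≡x!*[n∸x]! x n x≤n)) (sym (*-assoc (suc x) (x !) _))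

-- Fractions of natural numbers in ℚ

toℚᵘ-/ : ∀ a m → toℚᵘ (+ a / suc m) ℚᵘ.≃ mkℚᵘ (+ a) m
toℚᵘ-/ a m = toℚᵘ-fromℚᵘ (mkℚᵘ (+ a) m)

+/≤+/⇒*≤* : ∀ a b m q → + a / suc m ≤ℚ + b / suc q → a * suc q ≤ b * suc m
+/≤+/⇒*≤* a b m q a/m≤b/q
  with ℚᵘ.≤-respʳ-≃ (toℚᵘ-/ b q) (ℚᵘ.≤-respˡ-≃ (toℚᵘ-/ a m) (toℚᵘ-mono-≤ a/m≤b/q))
... | *≤* aq≤bm = ℤ.drop‿+≤+ (subst₂ ℤ._≤_ (sym (ℤ.pos-* a (suc q))) (sym (ℤ.pos-* b (suc m))) aq≤bm)

*≤*⇒+/≤+/ : ∀ a b m q → a * suc q ≤ b * suc m → + a / suc m ≤ℚ + b / suc q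
*≤*⇒+/≤+/ a b m q aq≤bm = toℚᵘ-cancel-≤
  (ℚᵘ.≤-respʳ-≃ (ℚᵘ.≃-sym (toℚᵘ-/ b q)) (ℚᵘ.≤-respˡ-≃ (ℚᵘ.≃-sym (toℚᵘ-/ a m))
    (*≤* (subst₂ ℤ._≤_ (ℤ.pos-* a (suc q)) (ℤ.pos-* b (suc m)) (ℤ.+≤+ aq≤bm)))))

+/-*-ℕ→ℚ : ∀ a b M .{{_ : NonZero M}} → (+ a / M) *ℚ ℕ→ℚ b ≡ + (a * b) / M
+/-*-ℕ→ℚ a b (suc m) = toℚᵘ-injective (begin
  toℚᵘ ((+ a / suc m) *ℚ ℕ→ℚ b)          ≈⟨ toℚᵘ-homo-* (+ a / suc m) (ℕ→ℚ b) ⟩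
  toℚᵘ (+ a / suc m) ℚᵘ.* toℚᵘ (ℕ→ℚ b)   ≈⟨ ℚᵘ.*-cong (toℚᵘ-/ a m) (toℚᵘ-/ b 0) ⟩
  mkℚᵘ (+ a) m ℚᵘ.* mkℚᵘ (+ b) 0          ≈⟨ *≡* (cong₂ ℤ._*_ (sym (ℤ.pos-* a b)) (cong +_ (sym (*-identityʳ (suc m))))) ⟩
  mkℚᵘ (+ (a * b)) m                       ≈⟨ toℚᵘ-/ (a * b) m ⟨
  toℚᵘ (+ (a * b) / suc m)                 ∎)
  where open ℚᵘ.≃-Reasoning

ℕ→ℚ-* : ∀ a b → ℕ→ℚ (a * b) ≡ ℕ→ℚ a *ℚ ℕ→ℚ b
ℕ→ℚ-* a b = sym (+/-*-ℕ→ℚ a b 1)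

∣⊖∣≡∣-∣ : ∀ x j → ℤ.∣ x ℤ.⊖ j ∣ ≡ ∣ x - j ∣
∣⊖∣≡∣-∣ x j with ≤-total x j
... | inj₁ x≤j = trans (ℤ.∣⊖∣-≤ x≤j) (sym (m≤n⇒∣m-n∣≡n∸m x≤j))
... | inj₂ j≤x = trans (ℤ.∣m⊖n∣≡∣n⊖m∣ x j) (trans (ℤ.∣⊖∣-≤ j≤x) (sym (m≤n⇒∣n-m∣≡n∸m j≤x)))

∣ℕ→ℚ-ℕ→ℚ∣ : ∀ x j → ∣ ℕ→ℚ x -ℚ ℕ→ℚ j ∣ℚ ≡ ℕ→ℚ ∣ x - j ∣
∣ℕ→ℚ-ℕ→ℚ∣ x j = toℚᵘ-injective (begin
  toℚᵘ ∣ ℕ→ℚ x -ℚ ℕ→ℚ j ∣ℚ                     ≈⟨ toℚᵘ-homo-∣-∣ (ℕ→ℚ x -ℚ ℕ→ℚ j) ⟩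
  ℚᵘ.∣ toℚᵘ (ℕ→ℚ x -ℚ ℕ→ℚ j) ∣                 ≈⟨ ℚᵘ.∣-∣-cong (ℚᵘ.≃-trans (toℚᵘ-homo-+ (ℕ→ℚ x) (ℚ.- ℕ→ℚ j))
                                                      (ℚᵘ.+-cong (toℚᵘ-/ x 0) (ℚᵘ.≃-trans (toℚᵘ-homo‿- (ℕ→ℚ j)) (ℚᵘ.-‿cong (toℚᵘ-/ j 0))))) ⟩
  ℚᵘ.∣ mkℚᵘ (+ x) 0 ℚᵘ.- mkℚᵘ (+ j) 0 ∣         ≈⟨ *≡* (cong (λ z → + z ℤ.* + 1) ∣x-j∣) ⟩
  mkℚᵘ (+ ∣ x - j ∣) 0                          ≈⟨ toℚᵘ-/ ∣ x - j ∣ 0 ⟨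
  toℚᵘ (ℕ→ℚ ∣ x - j ∣)                         ∎)
  where
  open ℚᵘ.≃-Reasoning
  ∣x-j∣ : ℤ.∣ + x ℤ.* + 1 ℤ.+ ℤ.- (+ j) ℤ.* + 1 ∣ ≡ ∣ x - j ∣
  ∣x-j∣ = trans (cong ℤ.∣_∣ (trans (cong₂ ℤ._+_ (ℤ.*-identityʳ (+ x)) (ℤ.*-identityʳ (ℤ.- + j))) (ℤ.m-n≡m⊖n x j)))
                (∣⊖∣≡∣-∣ x j)

∣prodℚ-differences∣ : ∀ x (L : List ℕ) →
  ∣ prodℚ (map (λ j → ℕ→ℚ x -ℚ ℕ→ℚ j) L) ∣ℚ ≡ ℕ→ℚ (product (map (λ j → ∣ x - j ∣) L))
∣prodℚ-differences∣ x []      = refl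
∣prodℚ-differences∣ x (j ∷ L) = begin
  ∣ (ℕ→ℚ x -ℚ ℕ→ℚ j) *ℚ rest ∣ℚ            ≡⟨ ℚP.∣p*q∣≡∣p∣*∣q∣ (ℕ→ℚ x -ℚ ℕ→ℚ j) rest ⟩
  ∣ ℕ→ℚ x -ℚ ℕ→ℚ j ∣ℚ *ℚ ∣ rest ∣ℚ          ≡⟨ cong₂ _*ℚ_ (∣ℕ→ℚ-ℕ→ℚ∣ x j) (∣prodℚ-differences∣ x L) ⟩
  ℕ→ℚ ∣ x - j ∣ *ℚ ℕ→ℚ restℕ                ≡⟨ ℕ→ℚ-* ∣ x - j ∣ restℕ ⟨
  ℕ→ℚ (∣ x - j ∣ * restℕ)                    ∎
  where
  open ≡-Reasoning
  rest : ℚ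
  rest = prodℚ (map (λ j → ℕ→ℚ x -ℚ ℕ→ℚ j) L)
  restℕ : ℕ
  restℕ = product (map (λ j → ∣ x - j ∣) L)

∣signℚ∣ : ∀ s → ∣ signℚ s ∣ℚ ≡ 1ℚ
∣signℚ∣ true  = refl
∣signℚ∣ false = refl

0≤+/ : ∀ a M .{{_ : NonZero M}} → 0ℚ ≤ℚ + a / M
0≤+/ a (suc m) = *≤*⇒+/≤+/ 0 a 0 m z≤n

∣signℚ*/*prodℚ∣ : ∀ s a M .{{_ : NonZero M}} x (L : List ℕ) →
  ∣ signℚ s *ℚ (+ a / M) *ℚ prodℚ (map (λ j → ℕ→ℚ x -ℚ ℕ→ℚ j) L) ∣ℚ ≡
  (+ a / M) *ℚ ℕ→ℚ (product (map (λ j → ∣ x - j ∣) L))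
∣signℚ*/*prodℚ∣ s a M x L = begin
  ∣ signℚ s *ℚ a/m *ℚ Π ∣ℚ        ≡⟨ ℚP.∣p*q∣≡∣p∣*∣q∣ (signℚ s *ℚ a/m) Π ⟩
  ∣ signℚ s *ℚ a/m ∣ℚ *ℚ ∣ Π ∣ℚ   ≡⟨ cong (_*ℚ ∣ Π ∣ℚ) (ℚP.∣p*q∣≡∣p∣*∣q∣ (signℚ s) a/m) ⟩
  ∣ signℚ s ∣ℚ *ℚ ∣ a/m ∣ℚ *ℚ ∣ Π ∣ℚ ≡⟨ cong₂ (λ u v → u *ℚ v *ℚ ∣ Π ∣ℚ) (∣signℚ∣ s) (ℚP.0≤p⇒∣p∣≡p (0≤+/ a M)) ⟩
  1ℚ *ℚ a/m *ℚ ∣ Π ∣ℚ             ≡⟨ cong₂ _*ℚ_ (ℚP.*-identityˡ a/m) (∣prodℚ-differences∣ x L) ⟩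
  a/m *ℚ ℕ→ℚ (product (map (λ j → ∣ x - j ∣) L)) ∎
  where
  open ≡-Reasoning
  a/m : ℚ
  a/m = + a / M
  Π : ℚ
  Π = prodℚ (map (λ j → ℕ→ℚ x -ℚ ℕ→ℚ j) L)

ℕ→ℚ-*-+/ : ∀ k a M .{{_ : NonZero M}} → ℕ→ℚ k *ℚ (+ a / M) ≡ + (k * a) / M
ℕ→ℚ-*-+/ k a M = begin
  ℕ→ℚ k *ℚ (+ a / M)  ≡⟨ ℚP.*-comm (ℕ→ℚ k) (+ a / M) ⟩
  (+ a / M) *ℚ ℕ→ℚ k  ≡⟨ +/-*-ℕ→ℚ a k M ⟩
  + (a * k) / M       ≡⟨ cong (λ z → + z / M) (*-comm a k) ⟩
  + (k * a) / M       ∎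
  where open ≡-Reasoning

+/≤recipℕ : ∀ a D M .{{_ : NonZero M}} → 1 ≤ D → a * D ≤ M → + a / M ≤ℚ recipℕ D
+/≤recipℕ a (suc d) (suc m) _ aD≤M = *≤*⇒+/≤+/ a 1 m d (subst (a * suc d ≤_) (sym (*-identityˡ (suc m))) aD≤M)

ℕ→ℚ-nonNeg : ∀ a → ℚ.NonNegative (ℕ→ℚ a)
ℕ→ℚ-nonNeg a = ℚ.nonNegative (0≤+/ a 1)

ℕ→ℚ≤+/*ℕ→ℚ⇒*≤* : ∀ a p q b → ℕ→ℚ a ≤ℚ (+ p / suc q) *ℚ ℕ→ℚ b → a * suc q ≤ p * b
ℕ→ℚ≤+/*ℕ→ℚ⇒*≤* a p q b a≤pb/q =
  subst (a * suc q ≤_) (*-identityʳ (p * b)) (+/≤+/⇒*≤* a (p * b) 0 q (subst (ℕ→ℚ a ≤ℚ_) (+/-*-ℕ→ℚ p b (suc q)) a≤pb/q))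

1+4/32≡9/8 : 1ℚ +ℚ ℕ→ℚ 4 *ℚ (+ 1 / 32) ≡ + 9 / 8
1+4/32≡9/8 = refl

[4+m]%4≡m%4 : ∀ m → (4 + m) % 4 ≡ m % 4
[4+m]%4≡m%4 m = trans (cong (_% 4) (+-comm 4 m)) ([m+n]%n≡m%n m 4)

[m+1]%4≢m%4 : ∀ m → (m + 1) % 4 ≢ m % 4
[m+1]%4≢m%4 0 ()
[m+1]%4≢m%4 1 ()
[m+1]%4≢m%4 2 ()
[m+1]%4≢m%4 3 ()
[m+1]%4≢m%4 (suc (suc (suc (suc m)))) eq =
  [m+1]%4≢m%4 m (trans (sym ([4+m]%4≡m%4 (m + 1))) (trans eq ([4+m]%4≡m%4 m)))

nCk*k!*[n∸k]!≡n! : ∀ n k → k ≤ n → (n C k) * (k ! * (n ∸ k) !) ≡ n !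
nCk*k!*[n∸k]!≡n! n k k≤n =
  trans (cong (_* (k ! * (n ∸ k) !)) (nCk≡n!/k![n-k]! k≤n)) (m/n*n≡m {{k !* (n ∸ k) !≢0}} (k![n∸k]!∣n! k≤n))

+≤⇒≤∣-∣ : ∀ {m a x} → m + a ≤ x → m ≤ ∣ x - a ∣
+≤⇒≤∣-∣ {m} {a} {x} m+a≤x =
  subst (m ≤_) (sym (m≤n⇒∣n-m∣≡n∸m (≤-trans (m≤n+m a m) m+a≤x))) (m+n≤o⇒m≤o∸n m m+a≤x)

∣m+n-m∣≡n : ∀ m n → ∣ m + n - m ∣ ≡ n
∣m+n-m∣≡n m n = trans (∣-∣-comm (m + n) m) (∣m-m+n∣≡n m n)

-- With d, a, b, c standing for j = x, j ∈ S, j = i* − 1 and j = i* + 1, this splits the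
-- factor of x! (n − x)! at j into the factors of ∏_{j ∉ T}, π_S(x) and the two distances.
if-partition : ∀ (d a b c : Bool) (m : ℕ) → (T d → T a) →
               (T a → T b → ⊥) → (T a → T c → ⊥) → (T b → T c → ⊥) →
               (if d then 1 else m) ≡
               (if not (a ∨ b ∨ c) then m else 1) *
               ((if a then (if not d then m else 1) else 1) * ((if b then m else 1) * (if c then m else 1)))
if-partition true  false _     _     m d⇒a _   _   _   = ⊥-elim (d⇒a _)
if-partition _     true  true  _     m _   a#b _   _   = ⊥-elim (a#b _ _)
if-partition _     true  false true  m _   _   a#c _   = ⊥-elim (a#c _ _)
if-partition _     false true  true  m _   _   _   b#c = ⊥-elim (b#c _ _)
if-partition true  true  false false m _   _   _   _   = refl
if-partition false true  false false m _   _   _   _   = sym (trans (*-identityˡ (m * 1)) (*-identityʳ m))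
if-partition false false false false m _   _   _   _   = sym (*-identityʳ m)
if-partition false false true  false m _   _   _   _   =
  sym (trans (*-identityˡ (1 * (m * 1))) (trans (*-identityˡ (m * 1)) (*-identityʳ m)))
if-partition false false false true  m _   _   _   _   =
  sym (trans (*-identityˡ (1 * (1 * m))) (trans (*-identityˡ (1 * m)) (*-identityˡ m)))

16[1+L]²∸1≡ : ∀ L → 16 * suc L * suc L ∸ 1 ≡ (4 * L + 3) * (4 * L + 5)
16[1+L]²∸1≡ L = cong (_∸ 1) (16[1+L]²≡ L)
  where
  16[1+L]²≡ : ∀ L → 16 * suc L * suc L ≡ suc ((4 * L + 3) * (4 * L + 5))
  16[1+L]²≡ = solve-∀

1≤16[1+L]²∸1 : ∀ L → 1 ≤ 16 * suc L * suc L ∸ 1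
1≤16[1+L]²∸1 L = subst (1 ≤_) (sym (16[1+L]²∸1≡ L)) (*-mono-≤ (≤-trans (s≤s z≤n) (m≤n+m 3 (4 * L))) (≤-trans (s≤s z≤n) (m≤n+m 5 (4 * L))))

-- The set S and a minimiser of π_S

module Setting (n t : ℕ) (c : ℚ) (2≤t : 2 ≤ t) (2t≤n : 2 * t ≤ n) (c≤1/32 : c ≤ℚ + 1 / 32) where

  data InS (j : ℕ) : Set where
    tk²+4ℓ : ∀ k ℓ → 1 ≤ k → t * k * k ≤ n ∸ t + 1 → 4 * ℓ < t → j ≡ t * k * k + 4 * ℓ → InS j
    t-4ℓ   : ∀ ℓ → 4 * ℓ < t → j + 4 * ℓ ≡ t → InS j

  ≤ct⇒4ℓ<t : ∀ ℓ → T (le-ct c t ℓ) → 4 * ℓ < t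
  ≤ct⇒4ℓ<t zero    _    = ≤-trans (s≤s z≤n) 2≤t
  ≤ct⇒4ℓ<t (suc ℓ) ℓ≤ct = begin-strict
    4 * suc ℓ    <⟨ *-monoˡ-< (suc ℓ) (m≤m+n 5 27) ⟩
    32 * suc ℓ   ≡⟨ *-comm 32 (suc ℓ) ⟩
    suc ℓ * 32   ≤⟨ ℕ→ℚ≤+/*ℕ→ℚ⇒*≤* (suc ℓ) 1 31 t (ℚP.≤-trans (toWitness ℓ≤ct) (ℚP.*-monoʳ-≤-nonNeg (ℕ→ℚ t) {{ℕ→ℚ-nonNeg t}} c≤1/32)) ⟩
    1 * t        ≡⟨ *-identityˡ t ⟩
    t            ∎
    where open ≤-Reasoning

  inS⇒InS : ∀ j → inS n t c j ≡ true → InS j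
  inS⇒InS j j∈S with T-∨ .to (T-≡ .from j∈S)
  ... | inj₁ square =
    let k , ∃ℓ = satisfied (any⁻ (λ k → any (square-witness k) (upTo (suc t))) (upTo (suc n)) square)
        ℓ , conds = satisfied (any⁻ (square-witness k) (upTo (suc t)) ∃ℓ)
        1≤k , conds′ = T-∧ {1 ≤ᵇ k} .to conds
        tkk≤ , conds″ = T-∧ {t * k * k ≤ᵇ n ∸ t + 1} .to conds′
        ℓ≤ct , j≡ = T-∧ {le-ct c t ℓ} {j ≡ᵇ t * k * k + 4 * ℓ} .to conds″
    in tk²+4ℓ k ℓ (≤ᵇ⇒≤ 1 k 1≤k) (≤ᵇ⇒≤ (t * k * k) (n ∸ t + 1) tkk≤) (≤ct⇒4ℓ<t ℓ ℓ≤ct) (≡ᵇ⇒≡ j (t * k * k + 4 * ℓ) j≡)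
    where
    square-witness : ℕ → ℕ → Bool
    square-witness k ℓ = (1 ≤ᵇ k) ∧ (t * k * k ≤ᵇ (n ∸ t) + 1) ∧ le-ct c t ℓ ∧ (j ≡ᵇ t * k * k + 4 * ℓ)
  ... | inj₂ below =
    let ℓ , conds = satisfied (any⁻ (λ ℓ → le-ct c t ℓ ∧ (j + 4 * ℓ ≡ᵇ t)) (upTo (suc t)) below)
        ℓ≤ct , j+4ℓ≡ = T-∧ {le-ct c t ℓ} {j + 4 * ℓ ≡ᵇ t} .to conds
    in t-4ℓ ℓ (≤ct⇒4ℓ<t ℓ ℓ≤ct) (≡ᵇ⇒≡ (j + 4 * ℓ) t j+4ℓ≡)

  t≤n : t ≤ n
  t≤n = ≤-trans (m≤m+n t (t + 0)) 2t≤n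

  InS⇒≤n : ∀ {j} → InS j → j ≤ n
  InS⇒≤n (tk²+4ℓ k ℓ _ tkk≤ 4ℓ<t refl) = begin
    t * k * k + 4 * ℓ      ≤⟨ +-monoˡ-≤ (4 * ℓ) tkk≤ ⟩
    n ∸ t + 1 + 4 * ℓ      ≡⟨ +-assoc (n ∸ t) 1 (4 * ℓ) ⟩
    n ∸ t + suc (4 * ℓ)    ≤⟨ +-monoʳ-≤ (n ∸ t) 4ℓ<t ⟩
    n ∸ t + t              ≡⟨ m∸n+n≡m t≤n ⟩
    n                      ∎
    where open ≤-Reasoning
  InS⇒≤n {j} (t-4ℓ ℓ _ j+4ℓ≡t) = ≤-trans (≤-trans (m≤m+n j (4 * ℓ)) (≤-reflexive j+4ℓ≡t)) t≤n

  InS⇒1≤ : ∀ {j} → InS j → 1 ≤ j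
  InS⇒1≤ (tk²+4ℓ k ℓ 1≤k _ _ refl) =
    ≤-trans (*-mono-≤ (*-mono-≤ (≤-trans (s≤s z≤n) 2≤t) 1≤k) 1≤k) (m≤m+n (t * k * k) (4 * ℓ))
  InS⇒1≤ {j} (t-4ℓ ℓ 4ℓ<t j+4ℓ≡t) = +-cancelʳ-< (4 * ℓ) 0 j (subst (4 * ℓ <_) (sym j+4ℓ≡t) 4ℓ<t)

  InS⇒%4 : ∀ {j} → InS j → j < 4 * t → j % 4 ≡ t % 4
  InS⇒%4 (tk²+4ℓ 1 ℓ _ _ _ refl) _ = begin
    (t * 1 * 1 + 4 * ℓ) % 4  ≡⟨ cong (λ z → (z + 4 * ℓ) % 4) (trans (*-identityʳ (t * 1)) (*-identityʳ t)) ⟩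
    (t + 4 * ℓ) % 4          ≡⟨ cong (λ z → (t + z) % 4) (*-comm 4 ℓ) ⟩
    (t + ℓ * 4) % 4          ≡⟨ [m+kn]%n≡m%n t ℓ 4 ⟩
    t % 4                    ∎
    where open ≡-Reasoning
  InS⇒%4 (tk²+4ℓ (suc (suc k)) ℓ _ _ _ refl) j<4t = ⊥-elim (<⇒≱ j<4t (begin
    4 * t                                     ≡⟨ *-comm 4 t ⟩
    t * 4                                     ≡⟨ *-assoc t 2 2 ⟨
    t * 2 * 2                                 ≤⟨ *-mono-≤ (*-monoʳ-≤ t 2≤k) 2≤k ⟩
    t * suc (suc k) * suc (suc k)             ≤⟨ m≤m+n _ (4 * ℓ) ⟩
    t * suc (suc k) * suc (suc k) + 4 * ℓ     ∎))
    where
    open ≤-Reasoning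
    2≤k : 2 ≤ suc (suc k)
    2≤k = s≤s (s≤s z≤n)
  InS⇒%4 {j} (t-4ℓ ℓ _ j+4ℓ≡t) _ = begin
    j % 4              ≡⟨ [m+kn]%n≡m%n j ℓ 4 ⟨
    (j + ℓ * 4) % 4    ≡⟨ cong (λ z → (j + z) % 4) (*-comm ℓ 4) ⟩
    (j + 4 * ℓ) % 4    ≡⟨ cong (_% 4) j+4ℓ≡t ⟩
    t % 4              ∎
    where open ≡-Reasoning

  adjacent-∉S : ∀ m → m + 1 < 4 * t → inS n t c m ≡ true → inS n t c (m + 1) ≡ true → ⊥
  adjacent-∉S m m+1<4t m∈S m+1∈S = [m+1]%4≢m%4 m (trans (InS⇒%4 (inS⇒InS _ m+1∈S) m+1<4t)
    (sym (InS⇒%4 (inS⇒InS m m∈S) (≤-<-trans (m≤m+n m 1) m+1<4t))))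

  ≤[1+4c]t⇒+1≤2t : ∀ i → ℕ→ℚ i ≤ℚ (1ℚ +ℚ ℕ→ℚ 4 *ℚ c) *ℚ ℕ→ℚ t → i + 1 ≤ 2 * t
  ≤[1+4c]t⇒+1≤2t i i≤[1+4c]t = *-cancelʳ-≤ (i + 1) (2 * t) 8 (begin
    (i + 1) * 8    ≡⟨ *-distribʳ-+ 8 i 1 ⟩
    i * 8 + 8      ≤⟨ +-mono-≤ 8i≤9t (≤-trans (m≤m+n 8 6) (*-monoʳ-≤ 7 2≤t)) ⟩
    9 * t + 7 * t  ≡⟨ 9t+7t≡2t*8 t ⟩
    2 * t * 8      ∎)
    where
    open ≤-Reasoning
    9t+7t≡2t*8 : ∀ t → 9 * t + 7 * t ≡ 2 * t * 8
    9t+7t≡2t*8 = solve-∀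
    8i≤9t : i * 8 ≤ 9 * t
    8i≤9t = ℕ→ℚ≤+/*ℕ→ℚ⇒*≤* i 9 7 t (ℚP.≤-trans i≤[1+4c]t
              (subst (λ q → (1ℚ +ℚ ℕ→ℚ 4 *ℚ c) *ℚ ℕ→ℚ t ≤ℚ q *ℚ ℕ→ℚ t) 1+4/32≡9/8
                (ℚP.*-monoʳ-≤-nonNeg (ℕ→ℚ t) {{ℕ→ℚ-nonNeg t}}
                  (ℚP.+-monoʳ-≤ 1ℚ (ℚP.*-monoˡ-≤-nonNeg (ℕ→ℚ 4) {{ℕ→ℚ-nonNeg 4}} c≤1/32)))))

  module Centre (i : ℕ) (i∈S : inS n t c i ≡ true) (i+1≤2t : i + 1 ≤ 2 * t)
                (π-minimal : ∀ j → inS n t c j ≡ true → piS n t c i ≤ piS n t c j) where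

    i∸1+1≡i : i ∸ 1 + 1 ≡ i
    i∸1+1≡i = m∸n+n≡m (InS⇒1≤ (inS⇒InS i i∈S))

    i+1≤n : i + 1 ≤ n
    i+1≤n = ≤-trans i+1≤2t 2t≤n

    i+1<4t : i + 1 < 4 * t
    i+1<4t = ≤-<-trans i+1≤2t (begin-strict
      2 * t          <⟨ m<m+n (2 * t) (≤-trans (s≤s z≤n) (*-monoʳ-≤ 2 2≤t)) ⟩
      2 * t + 2 * t  ≡⟨ *-distribʳ-+ t 2 2 ⟨
      4 * t          ∎)
      where open ≤-Reasoning

    below-i∉S : ∀ j → j + 1 ≡ i → inS n t c j ≡ true → ⊥
    below-i∉S j refl j∈S = adjacent-∉S j (<-trans (m<m+n (j + 1) (s≤s z≤n)) i+1<4t) j∈S i∈S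

    above-i∉S : ∀ j → j ≡ i + 1 → inS n t c j ≡ true → ⊥
    above-i∉S j refl j∈S = adjacent-∉S i i+1<4t i∈S j∈S

    ∏∉T : ℕ → ℕ
    ∏∉T x = product (map (λ j → ∣ x - j ∣) (filterᵇ (λ j → not (inT n t c i j)) (upTo (suc n))))

    ∉T-factor ∈S∖x-factor i∸1-factor i+1-factor : ℕ → ℕ → ℕ
    ∉T-factor x j   = if not (inT n t c i j) then ∣ x - j ∣ else 1
    ∈S∖x-factor x j = if inS n t c j then (if not (j ≡ᵇ x) then ∣ x - j ∣ else 1) else 1
    i∸1-factor x j  = if j + 1 ≡ᵇ i then ∣ x - j ∣ else 1
    i+1-factor x j  = if j ≡ᵇ i + 1 then ∣ x - j ∣ else 1

    ∏∉T≡∏< : ∀ x → ∏∉T x ≡ ∏< (suc n) (∉T-factor x)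
    ∏∉T≡∏< x = trans (product-filterᵇ (λ j → not (inT n t c i j)) (λ j → ∣ x - j ∣) (upTo (suc n)))
                     (product-upTo (suc n) (∉T-factor x))

    piS≡∏< : ∀ x → piS n t c x ≡ ∏< (suc n) (∈S∖x-factor x)
    piS≡∏< x = begin
      piS n t c x
        ≡⟨ product-filterᵇ (λ j → not (j ≡ᵇ x)) (λ j → ∣ x - j ∣) (Slist n t c) ⟩
      product (map (λ j → if not (j ≡ᵇ x) then ∣ x - j ∣ else 1) (Slist n t c))
        ≡⟨ product-filterᵇ (inS n t c) (λ j → if not (j ≡ᵇ x) then ∣ x - j ∣ else 1) (upTo (n + 4 * t + 2)) ⟩
      product (map (∈S∖x-factor x) (upTo (n + 4 * t + 2)))
        ≡⟨ product-upTo (n + 4 * t + 2) (∈S∖x-factor x) ⟩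
      ∏< (n + 4 * t + 2) (∈S∖x-factor x)
        ≡⟨ cong (λ N → ∏< N (∈S∖x-factor x)) (trans (+-suc (n + 4 * t) 1) (cong suc (+-assoc n (4 * t) 1))) ⟩
      ∏< (suc n + (4 * t + 1)) (∈S∖x-factor x)
        ≡⟨ ∏<-+ (suc n) (4 * t + 1) (∈S∖x-factor x) ⟩
      ∏< (suc n) (∈S∖x-factor x) * ∏< (4 * t + 1) (λ j → ∈S∖x-factor x (suc n + j))
        ≡⟨ cong (∏< (suc n) (∈S∖x-factor x) *_) (∏<-ones (4 * t + 1) beyond-n) ⟩
      ∏< (suc n) (∈S∖x-factor x) * 1
        ≡⟨ *-identityʳ _ ⟩
      ∏< (suc n) (∈S∖x-factor x) ∎
      where
      open ≡-Reasoning
      beyond-n : ∀ j → ∈S∖x-factor x (suc n + j) ≡ 1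
      beyond-n j = if-¬T (λ j∈S → <⇒≱ (s≤s (m≤m+n n j)) (InS⇒≤n (inS⇒InS _ (T-≡ .to j∈S))))

    ∏<-i∸1-factor : ∀ x → ∏< (suc n) (i∸1-factor x) ≡ ∣ x - (i ∸ 1) ∣
    ∏<-i∸1-factor x = ∏<-select (suc n) (λ j → j + 1 ≡ᵇ i) (λ j → ∣ x - j ∣) (i ∸ 1)
      (s≤s (≤-trans (m∸n≤m i 1) (≤-trans (m≤m+n i 1) i+1≤n)))
      (≡⇒≡ᵇ (i ∸ 1 + 1) i i∸1+1≡i)
      (λ j j+1≡i → trans (sym (m+n∸n≡m j 1)) (cong (_∸ 1) (≡ᵇ⇒≡ (j + 1) i j+1≡i)))

    ∏<-i+1-factor : ∀ x → ∏< (suc n) (i+1-factor x) ≡ ∣ x - (i + 1) ∣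
    ∏<-i+1-factor x = ∏<-select (suc n) (λ j → j ≡ᵇ i + 1) (λ j → ∣ x - j ∣) (i + 1)
      (s≤s i+1≤n) (≡⇒≡ᵇ (i + 1) (i + 1) refl) (λ j → ≡ᵇ⇒≡ j (i + 1))

    factor-partition : ∀ x → inS n t c x ≡ true → ∀ j →
      (if j ≡ᵇ x then 1 else ∣ x - j ∣) ≡
      ∉T-factor x j * (∈S∖x-factor x j * (i∸1-factor x j * i+1-factor x j))
    factor-partition x x∈S j = if-partition (j ≡ᵇ x) (inS n t c j) (j + 1 ≡ᵇ i) (j ≡ᵇ i + 1) ∣ x - j ∣
      (λ j≡x → T-≡ .from (subst (λ z → inS n t c z ≡ true) (sym (≡ᵇ⇒≡ j x j≡x)) x∈S))
      (λ j∈S j+1≡i → below-i∉S j (≡ᵇ⇒≡ (j + 1) i j+1≡i) (T-≡ .to j∈S))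
      (λ j∈S j≡i+1 → above-i∉S j (≡ᵇ⇒≡ j (i + 1) j≡i+1) (T-≡ .to j∈S))
      (λ j+1≡i j≡i+1 → m≢1+m+n i (sym (trans (+-comm 1 (i + 1))
         (subst (λ z → z + 1 ≡ i) (≡ᵇ⇒≡ j (i + 1) j≡i+1) (≡ᵇ⇒≡ (j + 1) i j+1≡i)))))

    factorial-factorisation : ∀ x → x ≤ n → inS n t c x ≡ true →
      x ! * (n ∸ x) ! ≡ ∏∉T x * (piS n t c x * (∣ x - (i ∸ 1) ∣ * ∣ x - (i + 1) ∣))
    factorial-factorisation x x≤n x∈S = begin
      x ! * (n ∸ x) !
        ≡⟨ ∏<-∣x-j∣≡x!*[n∸x]! x n x≤n ⟨
      ∏< (suc n) (λ j → if j ≡ᵇ x then 1 else ∣ x - j ∣)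
        ≡⟨ ∏<-cong (suc n) _ (λ j → ∉T-factor x j * (∈S∖x-factor x j * (i∸1-factor x j * i+1-factor x j)))
                   (factor-partition x x∈S) ⟩
      ∏< (suc n) (λ j → ∉T-factor x j * (∈S∖x-factor x j * (i∸1-factor x j * i+1-factor x j)))
        ≡⟨ ∏<-distrib-*⁴ (suc n) (∉T-factor x) (∈S∖x-factor x) (i∸1-factor x) (i+1-factor x) ⟩
      ∏< (suc n) (∉T-factor x) * (∏< (suc n) (∈S∖x-factor x) * (∏< (suc n) (i∸1-factor x) * ∏< (suc n) (i+1-factor x)))
        ≡⟨ cong₂ _*_ (sym (∏∉T≡∏< x)) (cong₂ _*_ (sym (piS≡∏< x)) (cong₂ _*_ (∏<-i∸1-factor x) (∏<-i+1-factor x))) ⟩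
      ∏∉T x * (piS n t c x * (∣ x - (i ∸ 1) ∣ * ∣ x - (i + 1) ∣)) ∎
      where open ≡-Reasoning

    ∉S⇒∉T : ∀ x → (T (inS n t c x) → ⊥) → ∣ x - (i ∸ 1) ∣ ≢ 0 → ∣ x - (i + 1) ∣ ≢ 0 → T (inT n t c i x) → ⊥
    ∉S⇒∉T x x∉S d₋≢0 d₊≢0 x∈T with T-∨ .to x∈T
    ... | inj₁ x∈S = x∉S x∈S
    ... | inj₂ x≡i±1 with T-∨ .to x≡i±1
    ... | inj₁ x+1≡i = d₋≢0 (subst (λ z → ∣ x - z ∣ ≡ 0)
                              (trans (sym (m+n∸n≡m x 1)) (cong (_∸ 1) (≡ᵇ⇒≡ (x + 1) i x+1≡i))) (∣n-n∣≡0 x))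
    ... | inj₂ x≡i+1 = d₊≢0 (subst (λ z → ∣ x - z ∣ ≡ 0) (≡ᵇ⇒≡ x (i + 1) x≡i+1) (∣n-n∣≡0 x))

    ∏∉T≡0 : ∀ x → x ≤ n → (T (inT n t c i x) → ⊥) → ∏∉T x ≡ 0
    ∏∉T≡0 x x≤n x∉T =
      trans (∏∉T≡∏< x) (∏<-zero (suc n) (∉T-factor x) x (s≤s x≤n) (trans (if-T (¬T⇒T-not x∉T)) (∣n-n∣≡0 x)))

    binomial-bound-∈S : ∀ x D → x ≤ n → inS n t c x ≡ true → D ≤ ∣ x - (i ∸ 1) ∣ * ∣ x - (i + 1) ∣ →
                        (n C x) * (piS n t c i * ∏∉T x) * D ≤ n !
    binomial-bound-∈S x D x≤n x∈S D≤d₋d₊ = begin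
      (n C x) * (piS n t c i * ∏∉T x) * D
        ≤⟨ *-mono-≤ (*-monoʳ-≤ (n C x) (*-monoˡ-≤ (∏∉T x) (π-minimal x x∈S))) D≤d₋d₊ ⟩
      (n C x) * (piS n t c x * ∏∉T x) * (∣ x - (i ∸ 1) ∣ * ∣ x - (i + 1) ∣)
        ≡⟨ rearrange (n C x) (piS n t c x) (∏∉T x) (∣ x - (i ∸ 1) ∣ * ∣ x - (i + 1) ∣) ⟩
      (n C x) * (∏∉T x * (piS n t c x * (∣ x - (i ∸ 1) ∣ * ∣ x - (i + 1) ∣)))
        ≡⟨ cong ((n C x) *_) (factorial-factorisation x x≤n x∈S) ⟨
      (n C x) * (x ! * (n ∸ x) !)
        ≡⟨ nCk*k!*[n∸k]!≡n! n x x≤n ⟩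
      n ! ∎
      where
      open ≤-Reasoning
      rearrange : ∀ a b c d → a * (b * c) * d ≡ a * (c * (b * d))
      rearrange = solve-∀

    binomial-bound : ∀ x D → 1 ≤ D → D ≤ ∣ x - (i ∸ 1) ∣ * ∣ x - (i + 1) ∣ →
                     (n C x) * (piS n t c i * ∏∉T x) * D ≤ n !
    binomial-bound x D 1≤D D≤d₋d₊ = by-cases (x ≤? n) (T? (inS n t c x))
      where
      d₋≢0 : ∣ x - (i ∸ 1) ∣ ≢ 0
      d₋≢0 d₋≡0 = <⇒≱ 1≤D (≤-trans D≤d₋d₊ (≤-reflexive (cong (_* ∣ x - (i + 1) ∣) d₋≡0)))
      d₊≢0 : ∣ x - (i + 1) ∣ ≢ 0
      d₊≢0 d₊≡0 = <⇒≱ 1≤D (≤-trans D≤d₋d₊ (≤-reflexive (trans (cong (∣ x - (i ∸ 1) ∣ *_) d₊≡0) (*-zeroʳ ∣ x - (i ∸ 1) ∣))))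
      by-cases : Dec (x ≤ n) → Dec (T (inS n t c x)) → (n C x) * (piS n t c i * ∏∉T x) * D ≤ n !
      by-cases (no x≰n)  _         =
        ≤-trans (≤-reflexive (cong (λ z → z * (piS n t c i * ∏∉T x) * D) (k>n⇒nCk≡0 (≰⇒> x≰n)))) z≤n
      by-cases (yes x≤n) (yes x∈S) = binomial-bound-∈S x D x≤n (T-≡ .to x∈S) D≤d₋d₊
      by-cases (yes x≤n) (no x∉S)  = ≤-trans (≤-reflexive (cong (_* D) (trans
        (cong (λ z → (n C x) * (piS n t c i * z)) (∏∉T≡0 x x≤n (∉S⇒∉T x x∉S d₋≢0 d₊≢0)))
        (trans (cong ((n C x) *_) (*-zeroʳ (piS n t c i))) (*-zeroʳ (n C x)))))) z≤n

    binomial-P-bound : ∀ s x D → 1 ≤ D → D ≤ ∣ x - (i ∸ 1) ∣ * ∣ x - (i + 1) ∣ →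
                       ℕ→ℚ (n C x) *ℚ ∣ P n t c i s (ℕ→ℚ x) ∣ℚ ≤ℚ recipℕ D
    binomial-P-bound s x D 1≤D D≤d₋d₊ = begin
      ℕ→ℚ (n C x) *ℚ ∣ P n t c i s (ℕ→ℚ x) ∣ℚ
        ≡⟨ cong (ℕ→ℚ (n C x) *ℚ_) (∣signℚ*/*prodℚ∣ s (piS n t c i) (n !) x
              (filterᵇ (λ j → not (inT n t c i j)) (upTo (suc n)))) ⟩
      ℕ→ℚ (n C x) *ℚ ((+ piS n t c i / n !) *ℚ ℕ→ℚ (∏∉T x))
        ≡⟨ cong (ℕ→ℚ (n C x) *ℚ_) (+/-*-ℕ→ℚ (piS n t c i) (∏∉T x) (n !)) ⟩
      ℕ→ℚ (n C x) *ℚ (+ (piS n t c i * ∏∉T x) / n !)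
        ≡⟨ ℕ→ℚ-*-+/ (n C x) (piS n t c i * ∏∉T x) (n !) ⟩
      + ((n C x) * (piS n t c i * ∏∉T x)) / n !
        ≤⟨ +/≤recipℕ ((n C x) * (piS n t c i * ∏∉T x)) D (n !) 1≤D (binomial-bound x D 1≤D D≤d₋d₊) ⟩
      recipℕ D ∎
      where
      open ℚP.≤-Reasoning
      instance
        n!≢0 : NonZero (n !)
        n!≢0 = n !≢0

    square-bound : ∀ s k ℓ → 2 ≤ k →
      ℕ→ℚ (n C (t * k * k + 4 * ℓ)) *ℚ ∣ P n t c i s (ℕ→ℚ (t * k * k + 4 * ℓ)) ∣ℚ
        ≤ℚ recipℕ (t * t * ((k * k ∸ 2) * (k * k ∸ 2)))
    square-bound s k ℓ 2≤k = binomial-P-bound s x (t * t * (w * w))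
        (≤-trans (*-mono-≤ 1≤z 1≤z) (≤-reflexive (sym D≡z*z)))
        (≤-trans (≤-reflexive D≡z*z) (*-mono-≤ z≤d₋ z≤d₊))
      where
      x w z : ℕ
      x = t * k * k + 4 * ℓ
      w = k * k ∸ 2
      z = t * w
      4≤k*k : 4 ≤ k * k
      4≤k*k = *-mono-≤ 2≤k 2≤k
      2≤w : 2 ≤ w
      2≤w = ∸-monoˡ-≤ 2 4≤k*k
      1≤z : 1 ≤ z
      1≤z = *-mono-≤ (≤-trans (s≤s z≤n) 2≤t) (≤-trans (s≤s z≤n) 2≤w)
      D≡z*z : t * t * (w * w) ≡ z * z
      D≡z*z = interchange t t w w
      tkk≡z+2t : t * k * k ≡ z + 2 * t
      tkk≡z+2t = begin
        t * k * k        ≡⟨ *-assoc t k k ⟩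
        t * (k * k)      ≡⟨ cong (t *_) (m∸n+n≡m (≤-trans (m≤n+m 2 2) 4≤k*k)) ⟨
        t * (w + 2)      ≡⟨ *-distribˡ-+ t w 2 ⟩
        z + t * 2        ≡⟨ cong (λ y → z + y) (*-comm t 2) ⟩
        z + 2 * t        ∎
        where open ≡-Reasoning
      z+[i+1]≤x : z + (i + 1) ≤ x
      z+[i+1]≤x = begin
        z + (i + 1)    ≤⟨ +-monoʳ-≤ z i+1≤2t ⟩
        z + 2 * t      ≡⟨ tkk≡z+2t ⟨
        t * k * k      ≤⟨ m≤m+n (t * k * k) (4 * ℓ) ⟩
        x              ∎
        where open ≤-Reasoning
      z≤d₊ : z ≤ ∣ x - (i + 1) ∣
      z≤d₊ = +≤⇒≤∣-∣ z+[i+1]≤x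
      z≤d₋ : z ≤ ∣ x - (i ∸ 1) ∣
      z≤d₋ = +≤⇒≤∣-∣ (≤-trans (+-monoʳ-≤ z (≤-trans (m∸n≤m i 1) (m≤m+n i 1))) z+[i+1]≤x)

    shift-bound : ∀ s (ℓ : ℤ) v → ℓ ≢ + 0 → + v ≡ + i +ℤ + 4 *ℤ ℓ →
      ℕ→ℚ (n C v) *ℚ ∣ P n t c i s (ℕ→ℚ v) ∣ℚ ≤ℚ recipℕ (16 * ∣ ℓ ∣ * ∣ ℓ ∣ ∸ 1)
    shift-bound s (+ zero)   v ℓ≢0 _  = ⊥-elim (ℓ≢0 refl)
    shift-bound s (+ suc L)  v _   v≡ = binomial-P-bound s v _ (1≤16[1+L]²∸1 L)
      (≤-reflexive (trans (16[1+L]²∸1≡ L) (trans (*-comm (4 * L + 3) (4 * L + 5)) (sym (cong₂ _*_ d₋ d₊)))))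
      where
      v≡i+4[1+L] : v ≡ i + 4 * suc L
      v≡i+4[1+L] = ℤ.+-injective v≡
      a+1+4[1+L]≡ : ∀ a L → a + 1 + 4 * suc L ≡ a + (4 * L + 5)
      a+1+4[1+L]≡ = solve-∀
      a+4[1+L]≡ : ∀ a L → a + 4 * suc L ≡ a + 1 + (4 * L + 3)
      a+4[1+L]≡ = solve-∀
      d₋ : ∣ v - (i ∸ 1) ∣ ≡ 4 * L + 5
      d₋ = trans (cong (λ y → ∣ y - (i ∸ 1) ∣)
                   (trans v≡i+4[1+L] (trans (cong (λ y → y + 4 * suc L) (sym i∸1+1≡i)) (a+1+4[1+L]≡ (i ∸ 1) L))))
                 (∣m+n-m∣≡n (i ∸ 1) (4 * L + 5))
      d₊ : ∣ v - (i + 1) ∣ ≡ 4 * L + 3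
      d₊ = trans (cong (λ y → ∣ y - (i + 1) ∣) (trans v≡i+4[1+L] (a+4[1+L]≡ i L))) (∣m+n-m∣≡n (i + 1) (4 * L + 3))
    shift-bound s -[1+ L ] v _   v≡ = binomial-P-bound s v _ (1≤16[1+L]²∸1 L)
      (≤-reflexive (trans (16[1+L]²∸1≡ L) (sym (cong₂ _*_ d₋ d₊))))
      where
      a≡a-4b+4b : ∀ a b → a ≡ (a +ℤ + 4 *ℤ ℤ.- b) +ℤ + 4 *ℤ b
      a≡a-4b+4b = solve-∀ℤ
      i≡v+4[1+L] : i ≡ v + 4 * suc L
      i≡v+4[1+L] = ℤ.+-injective (trans (a≡a-4b+4b (+ i) (+ suc L)) (cong (_+ℤ + 4 *ℤ + suc L) (sym v≡)))
      a+4[1+L]≡ : ∀ a L → a + 4 * suc L ≡ suc (a + (4 * L + 3))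
      a+4[1+L]≡ = solve-∀
      a+4[1+L]+1≡ : ∀ a L → a + 4 * suc L + 1 ≡ a + (4 * L + 5)
      a+4[1+L]+1≡ = solve-∀
      d₋ : ∣ v - (i ∸ 1) ∣ ≡ 4 * L + 3
      d₋ = trans (cong (λ y → ∣ v - y ∣) (cong (_∸ 1) (trans i≡v+4[1+L] (a+4[1+L]≡ v L)))) (∣m-m+n∣≡n v (4 * L + 3))
      d₊ : ∣ v - (i + 1) ∣ ≡ 4 * L + 5
      d₊ = trans (cong (λ y → ∣ v - y ∣) (trans (cong (_+ 1) i≡v+4[1+L]) (a+4[1+L]+1≡ v L))) (∣m-m+n∣≡n v (4 * L + 5))

lemma11 : (n t : ℕ) (c : ℚ) → 2 ≤ t → 2 * t ≤ n → 0ℚ ≤ℚ c → c ≤ℚ (+ 1 / 32) →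
          (istar : ℕ) → inS n t c istar ≡ true →
          (∀ i → inS n t c i ≡ true → piS n t c istar ≤ piS n t c i) →
          ((1ℚ -ℚ ℕ→ℚ 4 *ℚ c) *ℚ ℕ→ℚ t) ≤ℚ ℕ→ℚ istar →
          ℕ→ℚ istar ≤ℚ ((1ℚ +ℚ ℕ→ℚ 4 *ℚ c) *ℚ ℕ→ℚ t) →
          (s : Bool) →
          ((k ℓ : ℕ) → 2 ≤ k → ℕ→ℚ ℓ ≤ℚ (c *ℚ ℕ→ℚ t) →
            (ℕ→ℚ (n C (t * k * k + 4 * ℓ)) *ℚ ∣ P n t c istar s (ℕ→ℚ (t * k * k + 4 * ℓ)) ∣ℚ)
              ≤ℚ recipℕ (t * t * ((k * k ∸ 2) * (k * k ∸ 2))))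
          ×
          ((ℓ : ℤ) (v : ℕ) → ℓ ≢ + 0 → + v ≡ + istar +ℤ + 4 *ℤ ℓ → v ≤ n →
            (ℕ→ℚ (n C v) *ℚ ∣ P n t c istar s (ℕ→ℚ v) ∣ℚ)
              ≤ℚ recipℕ (16 * ∣ ℓ ∣ * ∣ ℓ ∣ ∸ 1))
lemma11 n t c 2≤t 2t≤n _ c≤1/32 istar istar∈S π-minimal _ istar≤[1+4c]t s =
  (λ k ℓ 2≤k _ → square-bound s k ℓ 2≤k) , (λ ℓ v ℓ≢0 v≡ _ → shift-bound s ℓ v ℓ≢0 v≡)
  where
  open Setting n t c 2≤t 2t≤n c≤1/32
  open Centre istar istar∈S (≤[1+4c]t⇒+1≤2t istar istar≤[1+4c]t) π-minimal
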